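{- Let $d,n\in\mathbb{N}$, $\bm s=(s_1,\dots,s_d)\in\mathbb{N}^d$ and $a,p\in\mathbb{R}$. Put $|\bm s|_r:=\sum_{i=1}^r s_i$ for $r=0,1,\dots,d$ (so $|\bm s|_0=0$) and $|\bm s|:=|\bm s|_d$. Then \[ \sum_{k=1}^n\binom nk p^k(1-p)^{n-k}\,\zeta_k^\star(s_1,\dots,s_d;a) =\sum_{n\ge n_1\ge\cdots\ge n_{|\bm s|}\ge 1} \frac{\prod_{r=1}^d(1-p)^{n_{|\bm s|_{r-1}+1}-n_{|\bm s|_r}}}{n_1\cdots n_{|\bm s|}}\Bigl[(1-p+ap)^{n_{|\bm s|}}-(1-p)^{n_{|\bm s|}}\Bigr]. \]
   Context: For $k\in\mathbb{N}$, positive integers $s_1,\dots,s_d$ and $a\in\mathbb{R}$, the generalized multiple harmonic-star value is $\zeta_k^\star(s_1,\dots,s_d;a):=\sum_{k\ge n_1\ge\cdots\ge n_d\ge 1}\frac{a^{n_d}}{n_1^{s_1}\cdots n_d^{s_d}}$ (the sum runs over integers). The convention $0^0=1$ is used. -}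

module Defs where

open import Level using (Level)
open import Algebra.Bundles using (CommutativeRing)
open import Data.Nat using (ℕ; zero; suc; _∸_)
open import Data.Nat.Combinatorics using (_C_)
open import Data.List using (List; []; _∷_; map; concatMap; upTo; take; length)
import Data.List as L
open import Data.Nat.ListAction using (sum)

-- 1-based indexing into a list of naturals (default 0 out of range)
idx : List ℕ → ℕ → ℕ
idx []       _             = 0
idx (x ∷ xs) zero          = 0
idx (x ∷ xs) (suc zero)    = x
idx (x ∷ xs) (suc (suc i)) = idx xs (suc i)

oneTo : ℕ → List ℕ
oneTo k = map suc (upTo k)

-- all chains (n₁,…,n_m) of integers with k ≥ n₁ ≥ ⋯ ≥ n_m ≥ 1
chains : ℕ → ℕ → List (List ℕ)
chains k zero    = [] ∷ []
chains k (suc m) = concatMap (λ j → map (j ∷_) (chains j m)) (oneTo k)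

psum : List ℕ → ℕ → ℕ
psum s r = sum (take r s)

module _ {c ℓ : Level} (R : CommutativeRing c ℓ) where
  open CommutativeRing R

  _-ᴿ_ : Carrier → Carrier → Carrier
  x -ᴿ y = x + (- y)

  fromℕ : ℕ → Carrier
  fromℕ zero    = 0#
  fromℕ (suc n) = 1# + fromℕ n

  pow : Carrier → ℕ → Carrier
  pow x zero    = 1#
  pow x (suc n) = x * pow x n

  sumR : List Carrier → Carrier
  sumR = L.foldr _+_ 0#

  prodR : List Carrier → Carrier
  prodR = L.foldr _*_ 1#

  -- ζ_k^⋆(s₁,…,s_d; a) = Σ_{k ≥ n₁ ≥ ⋯ ≥ n_d ≥ 1} a^{n_d} / (n₁^{s₁} ⋯ n_d^{s_d}),
  -- where inv m plays the role of 1/m (for m ≥ 1)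
  zetaStar : (inv : ℕ → Carrier) → ℕ → List ℕ → Carrier → Carrier
  zetaStar inv k s a =
    sumR (map (λ ns → pow a (idx ns (length s)) *
                      prodR (L.zipWith (λ n si → pow (inv n) si) ns s))
              (chains k (length s)))

  lhs2 : (inv : ℕ → Carrier) → ℕ → List ℕ → Carrier → Carrier → Carrier
  lhs2 inv n s a p =
    sumR (map (λ k → fromℕ (n C k) * pow p k * pow (1# -ᴿ p) (n ∸ k)
                     * zetaStar inv k s a)
              (oneTo n))

  rhs2 : (inv : ℕ → Carrier) → ℕ → List ℕ → Carrier → Carrier → Carrier
  rhs2 inv n s a p =
    sumR (map term (chains n N))
    where
      N : ℕ
      N = psum s (length s)
      term : List ℕ → Carrier
      term ns =
        prodR (map (λ r → pow (1# -ᴿ p)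
                              (idx ns (suc (psum s (r ∸ 1))) ∸ idx ns (psum s r)))
                   (oneTo (length s)))
        * prodR (map inv ns)
        * (pow ((1# -ᴿ p) + a * p) (idx ns N) -ᴿ pow (1# -ᴿ p) (idx ns N))

{-# OPTIONS --safe #-}

-- Write q = 1 - p and B_n f = Σ_{k=1}^n C(n,k) p^k q^(n-k) f(k). Pascal's rule gives
-- B_{n+1} f = q B_n f + p Σ_{k=0}^n C(n,k) p^k q^(n-k) f(k+1), and the absorption identity
-- (k+1) C(n+1,k+1) = (n+1) C(n,k) trades the factor 1/(k+1) for 1/(n+1). By induction on n,
--   B_n [k ↦ Σ_{j≤k} f(j)/j] = Σ_{m≤n} B_m f / m   and   B_n [k ↦ f(k)/k] = Σ_{m≤n} q^(n-m) B_m f / m.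
-- Since ζ⋆_k(s₁,…,s_d) = Σ_{j≤k} ζ⋆_j(s₂,…,s_d) / j^s₁, one use of the first identity followed by
-- s₁ - 1 uses of the second expands B_n ζ⋆(s) over a chain n ≥ n₁ ≥ ⋯ ≥ n_{s₁} with weight
-- q^(n₁ - n_{s₁}) / (n₁ ⋯ n_{s₁}), the powers of q telescoping. Iterating over the d blocks and
-- ending with the binomial theorem B_n [k ↦ a^k] = (q + ap)^n - q^n gives the right-hand side,
-- whose chains of length |s| split into the same d consecutive blocks.

module Submission where

open import Defs
open import Level using (Level)
open import Algebra.Bundles using (Monoid; CommutativeRing)
open import Data.Nat using (ℕ; zero; suc; _∸_; _≤_; _<_; z≤n; s≤s)
import Data.Nat as ℕ
open import Data.Nat.Properties using (≤-refl; ≤-trans; +-∸-assoc; m∸n+n≡m; n∸n≡0)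
import Data.Nat.Properties as ℕ
open import Data.Nat.Combinatorics using (_C_; nC1≡n; nCk+nC[k+1]≡[n+1]C[k+1]; k>n⇒nCk≡0)
open import Data.Nat.Solver using (module +-*-Solver)
open import Data.List using (List; []; _∷_; _++_; length; map; foldr; concatMap; applyUpTo; upTo; zipWith)
open import Data.List.Properties using (map-∘; map-++; map-cong; map-applyUpTo)
open import Data.List.Relation.Unary.All using (All; []; _∷_)
open import Data.Fin using (toℕ)
open import Data.Fin.Properties using (toℕ<n; toℕ-inject₁; toℕ-fromℕ)
open import Function using (_∘_; id)
open import Relation.Binary.PropositionalEquality as ≡ using (_≡_; cong; cong₂)

lastOr : ℕ → List ℕ → ℕ
lastOr k []       = k
lastOr k (j ∷ ns) = lastOr j ns

headOr : ℕ → List ℕ → ℕ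
headOr k []      = k
headOr k (j ∷ _) = j

lastOr-++ : ∀ k xs ys → lastOr k (xs ++ ys) ≡ lastOr (lastOr k xs) ys
lastOr-++ k []       ys = ≡.refl
lastOr-++ k (x ∷ xs) ys = lastOr-++ x xs ys

idx-length : ∀ k ns {m} → length ns ≡ m → 1 ≤ m → idx ns m ≡ lastOr k ns
idx-length k (j ∷ [])      ≡.refl _ = ≡.refl
idx-length k (j ∷ j′ ∷ ns) ≡.refl _ = idx-length j (j′ ∷ ns) ≡.refl (s≤s z≤n)

idx-++-length : ∀ k xs ys → 1 ≤ length xs → idx (xs ++ ys) (length xs) ≡ lastOr k xs
idx-++-length k (x ∷ [])      ys _ = ≡.refl
idx-++-length k (x ∷ x′ ∷ xs) ys _ = idx-++-length x (x′ ∷ xs) ys (s≤s z≤n)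

idx-++ʳ : ∀ xs ys i → idx (xs ++ ys) (suc (length xs ℕ.+ i)) ≡ idx ys (suc i)
idx-++ʳ []       ys i = ≡.refl
idx-++ʳ (x ∷ xs) ys i = idx-++ʳ xs ys i

map-oneTo : ∀ {a} {A : Set a} (f : ℕ → A) k → map f (oneTo k) ≡ applyUpTo (f ∘ suc) k
map-oneTo f k = ≡.trans (≡.sym (map-∘ (upTo k))) (map-applyUpTo id (f ∘ suc) k)

oneTo-suc : ∀ k → oneTo (suc k) ≡ 1 ∷ map suc (oneTo k)
oneTo-suc k = cong (λ ns → 1 ∷ map suc ns) (≡.sym (map-applyUpTo id suc k))

m∸n+n∸o≡m∸o : ∀ {m n o} → n ≤ m → o ≤ n → (m ∸ n) ℕ.+ (n ∸ o) ≡ m ∸ o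
m∸n+n∸o≡m∸o {m} {n} {o} n≤m o≤n =
  ≡.trans (≡.sym (+-∸-assoc (m ∸ n) o≤n)) (cong (_∸ o) (m∸n+n≡m n≤m))

[k+1]*[n+1]C[k+1]≡[n+1]*nCk : ∀ n k → suc k ℕ.* (suc n C suc k) ≡ suc n ℕ.* (n C k)
[k+1]*[n+1]C[k+1]≡[n+1]*nCk n       zero    =
  ≡.trans (ℕ.*-identityˡ _) (≡.trans (nC1≡n (suc n)) (≡.sym (ℕ.*-identityʳ (suc n))))
[k+1]*[n+1]C[k+1]≡[n+1]*nCk zero    (suc k) = ℕ.*-zeroʳ (suc (suc k))
[k+1]*[n+1]C[k+1]≡[n+1]*nCk (suc n) (suc k) = begin
  suc (suc k) * (suc (suc n) C suc (suc k))
    ≡⟨ cong (suc (suc k) *_) (nCk+nC[k+1]≡[n+1]C[k+1] (suc n) (suc k)) ⟨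
  suc (suc k) * (suc n C suc k + suc n C suc (suc k))
    ≡⟨ solve 3 (λ k x y → (con 2 :+ k) :* (x :+ y) := x :+ ((con 1 :+ k) :* x :+ (con 2 :+ k) :* y))
         ≡.refl k (suc n C suc k) (suc n C suc (suc k)) ⟩
  suc n C suc k + (suc k * (suc n C suc k) + suc (suc k) * (suc n C suc (suc k)))
    ≡⟨ cong (suc n C suc k +_)
         (cong₂ _+_ ([k+1]*[n+1]C[k+1]≡[n+1]*nCk n k) ([k+1]*[n+1]C[k+1]≡[n+1]*nCk n (suc k))) ⟩
  suc n C suc k + (suc n * (n C k) + suc n * (n C suc k))
    ≡⟨ cong (suc n C suc k +_) (ℕ.*-distribˡ-+ (suc n) (n C k) (n C suc k)) ⟨
  suc n C suc k + suc n * (n C k + n C suc k)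
    ≡⟨ cong (λ x → suc n C suc k + suc n * x) (nCk+nC[k+1]≡[n+1]C[k+1] n k) ⟩
  suc (suc n) * (suc n C suc k) ∎
  where
  open import Data.Nat using (_+_; _*_)
  open ≡.≡-Reasoning
  open +-*-Solver

module _ {ℓ₁ ℓ₂ : Level} (M : Monoid ℓ₁ ℓ₂) where
  open Monoid M

  foldr-∙-++ : ∀ xs ys → foldr _∙_ ε (xs ++ ys) ≈ foldr _∙_ ε xs ∙ foldr _∙_ ε ys
  foldr-∙-++ []       ys = sym (identityˡ _)
  foldr-∙-++ (x ∷ xs) ys = trans (∙-congˡ (foldr-∙-++ xs ys)) (sym (assoc _ _ _))

module Sums {ℓ₁ ℓ₂ : Level} (R : CommutativeRing ℓ₁ ℓ₂) where
  open CommutativeRing R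
  open import Algebra.Properties.Semiring.Sum semiring
    using (sum; sum-cong-≋; sum-cong-≗; sum-init-last; ∑-distrib-+; *-distribˡ-sum)
  open import Relation.Binary.Reasoning.Setoid setoid

  -- Opaque, so that unification compares sumUpTo n f with sumUpTo n g argument-wise
  -- instead of unfolding both to folds over Fin n.
  opaque
    sumUpTo : ℕ → (ℕ → Carrier) → Carrier
    sumUpTo n f = sum {n} (f ∘ toℕ)

  opaque
    unfolding sumUpTo

    sumUpTo≡sum : ∀ n f → sumUpTo n f ≡ sum {n} (f ∘ toℕ)
    sumUpTo≡sum n f = ≡.refl

    sumUpTo-zero : ∀ f → sumUpTo 0 f ≈ 0#
    sumUpTo-zero f = refl

    sumUpTo-sucˡ : ∀ n f → sumUpTo (suc n) f ≈ f 0 + sumUpTo n (f ∘ suc)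
    sumUpTo-sucˡ n f = refl

    sumUpTo-sucʳ : ∀ n f → sumUpTo (suc n) f ≈ sumUpTo n f + f n
    sumUpTo-sucʳ n f = trans (sum-init-last {n} (f ∘ toℕ))
      (reflexive (cong₂ _+_ (sum-cong-≗ {n} (cong f ∘ toℕ-inject₁)) (cong f (toℕ-fromℕ n))))

    sumUpTo-cong : ∀ n {f g : ℕ → Carrier} → (∀ i → i < n → f i ≈ g i) → sumUpTo n f ≈ sumUpTo n g
    sumUpTo-cong n f≈g = sum-cong-≋ (λ i → f≈g (toℕ i) (toℕ<n i))

    sumUpTo-+ : ∀ n f g → sumUpTo n (λ i → f i + g i) ≈ sumUpTo n f + sumUpTo n g
    sumUpTo-+ n f g = ∑-distrib-+ {n} (f ∘ toℕ) (g ∘ toℕ)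

    *-distribˡ-sumUpTo : ∀ n x f → x * sumUpTo n f ≈ sumUpTo n (λ i → x * f i)
    *-distribˡ-sumUpTo n x f = *-distribˡ-sum {n} x (f ∘ toℕ)

    sumR-applyUpTo : ∀ n f → sumR R (applyUpTo f n) ≈ sumUpTo n f
    sumR-applyUpTo zero    f = refl
    sumR-applyUpTo (suc n) f = +-congˡ (sumR-applyUpTo n (f ∘ suc))

  sumR-oneTo : ∀ n f → sumR R (map f (oneTo n)) ≈ sumUpTo n (f ∘ suc)
  sumR-oneTo n f = trans (reflexive (cong (sumR R) (map-oneTo f n))) (sumR-applyUpTo n (f ∘ suc))

  sumR-concatMap : ∀ {A B : Set} (f : B → Carrier) (g : A → List B) xs →
    sumR R (map f (concatMap g xs)) ≈ sumR R (map (λ x → sumR R (map f (g x))) xs)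
  sumR-concatMap f g []       = refl
  sumR-concatMap f g (x ∷ xs) = begin
    sumR R (map f (g x ++ concatMap g xs))
      ≡⟨ cong (sumR R) (map-++ f (g x) (concatMap g xs)) ⟩
    sumR R (map f (g x) ++ map f (concatMap g xs))
      ≈⟨ foldr-∙-++ +-monoid (map f (g x)) _ ⟩
    sumR R (map f (g x)) + sumR R (map f (concatMap g xs))
      ≈⟨ +-congˡ (sumR-concatMap f g xs) ⟩
    sumR R (map (λ x → sumR R (map f (g x))) (x ∷ xs)) ∎

  *-distribˡ-sumR : ∀ {A : Set} x (f : A → Carrier) xs →
    x * sumR R (map f xs) ≈ sumR R (map (λ y → x * f y) xs)
  *-distribˡ-sumR x f []       = zeroʳ x
  *-distribˡ-sumR x f (y ∷ xs) = trans (distribˡ x _ _) (+-congˡ (*-distribˡ-sumR x f xs))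

  chainSum : ℕ → ℕ → (List ℕ → Carrier) → Carrier
  chainSum k m f = sumR R (map f (chains k m))

  chainSum-suc : ∀ k m f → chainSum k (suc m) f ≈ sumUpTo k (λ i → chainSum (suc i) m (f ∘ (suc i ∷_)))
  chainSum-suc k m f = begin
    chainSum k (suc m) f
      ≈⟨ sumR-concatMap f (λ j → map (j ∷_) (chains j m)) (oneTo k) ⟩
    sumR R (map (λ j → sumR R (map f (map (j ∷_) (chains j m)))) (oneTo k))
      ≡⟨ cong (sumR R) (map-cong (λ j → cong (sumR R) (≡.sym (map-∘ (chains j m)))) (oneTo k)) ⟩
    sumR R (map (λ j → chainSum j m (f ∘ (j ∷_))) (oneTo k))
      ≈⟨ sumR-oneTo k _ ⟩
    sumUpTo k (λ i → chainSum (suc i) m (f ∘ (suc i ∷_))) ∎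

  chainSum-cong : ∀ k m {f g : List ℕ → Carrier} →
    (∀ c → length c ≡ m → lastOr k c ≤ k → f c ≈ g c) → chainSum k m f ≈ chainSum k m g
  chainSum-cong k zero    f≈g = +-congʳ (f≈g [] ≡.refl ≤-refl)
  chainSum-cong k (suc m) {f} {g} f≈g = begin
    chainSum k (suc m) f
      ≈⟨ chainSum-suc k m f ⟩
    sumUpTo k (λ i → chainSum (suc i) m (f ∘ (suc i ∷_)))
      ≈⟨ sumUpTo-cong k (λ i i<k → chainSum-cong (suc i) m (λ c len last≤ →
           f≈g (suc i ∷ c) (cong suc len) (≤-trans last≤ i<k))) ⟩
    sumUpTo k (λ i → chainSum (suc i) m (g ∘ (suc i ∷_)))
      ≈⟨ chainSum-suc k m g ⟨
    chainSum k (suc m) g ∎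

  chainSum-*ˡ : ∀ k m x f → x * chainSum k m f ≈ chainSum k m (λ c → x * f c)
  chainSum-*ˡ k m x f = *-distribˡ-sumR x f (chains k m)

  chainSum-+ : ∀ k m₁ m₂ f →
    chainSum k (m₁ ℕ.+ m₂) f ≈ chainSum k m₁ (λ c → chainSum (lastOr k c) m₂ (f ∘ (c ++_)))
  chainSum-+ k zero     m₂ f = sym (+-identityʳ _)
  chainSum-+ k (suc m₁) m₂ f = begin
    chainSum k (suc (m₁ ℕ.+ m₂)) f
      ≈⟨ chainSum-suc k (m₁ ℕ.+ m₂) f ⟩
    sumUpTo k (λ i → chainSum (suc i) (m₁ ℕ.+ m₂) (f ∘ (suc i ∷_)))
      ≈⟨ sumUpTo-cong k (λ i _ → chainSum-+ (suc i) m₁ m₂ (f ∘ (suc i ∷_))) ⟩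
    sumUpTo k (λ i → chainSum (suc i) m₁ (λ c → chainSum (lastOr (suc i) c) m₂ (f ∘ ((suc i ∷ c) ++_))))
      ≈⟨ chainSum-suc k m₁ _ ⟨
    chainSum k (suc m₁) (λ c → chainSum (lastOr k c) m₂ (f ∘ (c ++_))) ∎

module Arithmetic {ℓ₁ ℓ₂ : Level} (R : CommutativeRing ℓ₁ ℓ₂) where
  open CommutativeRing R
  open import Algebra.Properties.Semiring.Mult semiring using (_×_)
  open import Algebra.Properties.Semiring.Exp semiring using (_^_)

  fromℕ-+ : ∀ m n → fromℕ R (m ℕ.+ n) ≈ fromℕ R m + fromℕ R n
  fromℕ-+ zero    n = sym (+-identityˡ _)
  fromℕ-+ (suc m) n = trans (+-congˡ (fromℕ-+ m n)) (sym (+-assoc _ _ _))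

  fromℕ-* : ∀ m n → fromℕ R (m ℕ.* n) ≈ fromℕ R m * fromℕ R n
  fromℕ-* zero    n = sym (zeroˡ _)
  fromℕ-* (suc m) n = trans (fromℕ-+ n (m ℕ.* n))
    (trans (+-cong (sym (*-identityˡ _)) (fromℕ-* m n)) (sym (distribʳ _ _ _)))

  fromℕ-*≈× : ∀ m x → fromℕ R m * x ≈ m × x
  fromℕ-*≈× zero    x = zeroˡ x
  fromℕ-*≈× (suc m) x = trans (distribʳ x 1# (fromℕ R m)) (+-cong (*-identityˡ x) (fromℕ-*≈× m x))

  pow≡^ : ∀ x n → pow R x n ≡ x ^ n
  pow≡^ x zero    = ≡.refl
  pow≡^ x (suc n) = cong (x *_) (pow≡^ x n)

  pow-+ : ∀ x m n → pow R x (m ℕ.+ n) ≈ pow R x m * pow R x n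
  pow-+ x zero    n = sym (*-identityˡ _)
  pow-+ x (suc m) n = trans (*-congˡ (pow-+ x m n)) (sym (*-assoc _ _ _))

  pow-∸-telescope : ∀ x {l m n} → l ≤ m → m ≤ n →
    pow R x (n ∸ m) * pow R x (m ∸ l) ≈ pow R x (n ∸ l)
  pow-∸-telescope x {l} {m} {n} l≤m m≤n =
    trans (sym (pow-+ x (n ∸ m) (m ∸ l))) (reflexive (cong (pow R x) (m∸n+n∸o≡m∸o m≤n l≤m)))

module _ {ℓ₁ ℓ₂ : Level} (R : CommutativeRing ℓ₁ ℓ₂) where
  open CommutativeRing R

  Reciprocals : (ℕ → Carrier) → Set ℓ₂
  Reciprocals inv = ∀ m → fromℕ R (suc m) * inv (suc m) ≈ 1#

module Binomial {ℓ₁ ℓ₂ : Level} (R : CommutativeRing ℓ₁ ℓ₂)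
  (inv : ℕ → CommutativeRing.Carrier R)
  (inv-correct : Reciprocals R inv)
  (p : CommutativeRing.Carrier R) where
  open CommutativeRing R
  open Sums R
  open Arithmetic R
  open import Algebra.Properties.Group +-group using (//-rightDividesˡ; //-rightDividesʳ)
  open import Algebra.Properties.Semiring.Mult semiring using (_×_)
  open import Algebra.Properties.CommutativeSemiring.Exp commutativeSemiring using (_^_; ^-congˡ; ^-distrib-*)
  open import Algebra.Properties.CommutativeSemiring.Binomial commutativeSemiring
    using (binomialExpansion) renaming (theorem to binomial-theorem)
  open import Relation.Binary.Reasoning.Setoid setoid
  open import Algebra.Solver.Ring.NaturalCoefficients.Default commutativeSemiring

  q : Carrier
  q = 1# - p

  q+p≈1 : q + p ≈ 1#
  q+p≈1 = //-rightDividesˡ p 1#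

  bernstein : ℕ → ℕ → Carrier
  bernstein n k = fromℕ R (n C k) * pow R p k * pow R q (n ∸ k)

  binomialSum₀ : ℕ → (ℕ → Carrier) → Carrier
  binomialSum₀ n f = sumUpTo (suc n) (λ k → bernstein n k * f k)

  binomialSum : ℕ → (ℕ → Carrier) → Carrier
  binomialSum n f = sumUpTo n (λ i → bernstein n (suc i) * f (suc i))

  binomialSum-cong : ∀ n {f g : ℕ → Carrier} → (∀ k → f k ≈ g k) → binomialSum n f ≈ binomialSum n g
  binomialSum-cong n f≈g = sumUpTo-cong n (λ i _ → *-congˡ (f≈g (suc i)))

  binomialSum-suc : ∀ n f → binomialSum (suc n) f ≈ q * binomialSum n f + p * binomialSum₀ n (f ∘ suc)
  binomialSum-suc n f = begin
    binomialSum (suc n) f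
      ≈⟨ sumUpTo-cong (suc n) (λ i _ → pascal i) ⟩
    sumUpTo (suc n) (λ i → p * (bernstein n i * f (suc i)) + r i)
      ≈⟨ sumUpTo-+ (suc n) _ r ⟩
    sumUpTo (suc n) (λ i → p * (bernstein n i * f (suc i))) + sumUpTo (suc n) r
      ≈⟨ +-cong (sym (*-distribˡ-sumUpTo (suc n) p _)) (sumUpTo-sucʳ n r) ⟩
    p * binomialSum₀ n (f ∘ suc) + (sumUpTo n r + r n)
      ≈⟨ +-congˡ (+-cong (sumUpTo-cong n r≈) r[n]≈0) ⟩
    p * binomialSum₀ n (f ∘ suc) + (sumUpTo n (λ i → q * (bernstein n (suc i) * f (suc i))) + 0#)
      ≈⟨ +-congˡ (trans (+-identityʳ _) (sym (*-distribˡ-sumUpTo n q _))) ⟩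
    p * binomialSum₀ n (f ∘ suc) + q * binomialSum n f
      ≈⟨ +-comm _ _ ⟩
    q * binomialSum n f + p * binomialSum₀ n (f ∘ suc) ∎
    where
    r : ℕ → Carrier
    r i = fromℕ R (n C suc i) * pow R p (suc i) * pow R q (n ∸ i) * f (suc i)
    pascal : ∀ i → bernstein (suc n) (suc i) * f (suc i) ≈ p * (bernstein n i * f (suc i)) + r i
    pascal i = begin
      fromℕ R (suc n C suc i) * (p * pow R p i) * pow R q (n ∸ i) * f (suc i)
        ≈⟨ *-congʳ (*-congʳ (*-congʳ (trans
             (reflexive (cong (fromℕ R) (≡.sym (nCk+nC[k+1]≡[n+1]C[k+1] n i))))
             (fromℕ-+ (n C i) (n C suc i))))) ⟩
      (fromℕ R (n C i) + fromℕ R (n C suc i)) * (p * pow R p i) * pow R q (n ∸ i) * f (suc i)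
        ≈⟨ solve 6 (λ A B P Pⁱ Q F →
               (A :+ B) :* (P :* Pⁱ) :* Q :* F := P :* (A :* Pⁱ :* Q :* F) :+ B :* (P :* Pⁱ) :* Q :* F)
             refl (fromℕ R (n C i)) (fromℕ R (n C suc i)) p (pow R p i) (pow R q (n ∸ i)) (f (suc i)) ⟩
      p * (bernstein n i * f (suc i)) + r i ∎
    r≈ : ∀ i → i < n → r i ≈ q * (bernstein n (suc i) * f (suc i))
    r≈ i i<n = trans (*-congʳ (*-congˡ (reflexive (cong (pow R q) (+-∸-assoc 1 i<n)))))
      (solve 5 (λ A P Q Qⁱ F → A :* P :* (Q :* Qⁱ) :* F := Q :* (A :* P :* Qⁱ :* F))
        refl (fromℕ R (n C suc i)) (pow R p (suc i)) q (pow R q (n ∸ suc i)) (f (suc i)))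
    r[n]≈0 : r n ≈ 0#
    r[n]≈0 = trans
      (*-congʳ (*-congʳ (*-congʳ (reflexive (cong (fromℕ R) (k>n⇒nCk≡0 {n} {suc n} ≤-refl))))))
      (solve 3 (λ P Q F → con 0 :* P :* Q :* F := con 0) refl (pow R p (suc n)) (pow R q (n ∸ n)) (f (suc n)))

  binomialSum₀≈bernstein₀+binomialSum : ∀ n f → binomialSum₀ n f ≈ bernstein n 0 * f 0 + binomialSum n f
  binomialSum₀≈bernstein₀+binomialSum n f = sumUpTo-sucˡ n _

  C-inv-absorb : ∀ n j → fromℕ R (n C j) * inv (suc j) ≈ inv (suc n) * fromℕ R (suc n C suc j)
  C-inv-absorb n j = begin
    X * J⁻¹
      ≈⟨ *-identityˡ _ ⟨
    1# * (X * J⁻¹)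
      ≈⟨ *-congʳ (trans (sym (inv-correct n)) (*-comm _ _)) ⟩
    (N⁻¹ * N) * (X * J⁻¹)
      ≈⟨ solve 4 (λ N⁻¹ N X J⁻¹ → (N⁻¹ :* N) :* (X :* J⁻¹) := N⁻¹ :* ((N :* X) :* J⁻¹))
           refl N⁻¹ N X J⁻¹ ⟩
    N⁻¹ * ((N * X) * J⁻¹)
      ≈⟨ *-congˡ (*-congʳ N*X≈J*Y) ⟩
    N⁻¹ * ((J * Y) * J⁻¹)
      ≈⟨ solve 4 (λ N⁻¹ J Y J⁻¹ → N⁻¹ :* ((J :* Y) :* J⁻¹) := (N⁻¹ :* Y) :* (J :* J⁻¹))
           refl N⁻¹ J Y J⁻¹ ⟩
    (N⁻¹ * Y) * (J * J⁻¹)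
      ≈⟨ *-congˡ (inv-correct j) ⟩
    (N⁻¹ * Y) * 1#
      ≈⟨ *-identityʳ _ ⟩
    N⁻¹ * Y ∎
    where
    X Y N J N⁻¹ J⁻¹ : Carrier
    X = fromℕ R (n C j)
    Y = fromℕ R (suc n C suc j)
    N = fromℕ R (suc n)
    J = fromℕ R (suc j)
    N⁻¹ = inv (suc n)
    J⁻¹ = inv (suc j)
    N*X≈J*Y : N * X ≈ J * Y
    N*X≈J*Y = begin
      N * X                         ≈⟨ fromℕ-* (suc n) (n C j) ⟨
      fromℕ R (suc n ℕ.* (n C j))   ≡⟨ cong (fromℕ R) ([k+1]*[n+1]C[k+1]≡[n+1]*nCk n j) ⟨
      fromℕ R (suc j ℕ.* (suc n C suc j)) ≈⟨ fromℕ-* (suc j) (suc n C suc j) ⟩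
      J * Y ∎

  binomialSum-absorb : ∀ n f →
    p * binomialSum₀ n (λ k → inv (suc k) * f (suc k)) ≈ inv (suc n) * binomialSum (suc n) f
  binomialSum-absorb n f = begin
    p * binomialSum₀ n (λ k → inv (suc k) * f (suc k))
      ≈⟨ *-distribˡ-sumUpTo (suc n) p _ ⟩
    sumUpTo (suc n) (λ j → p * (bernstein n j * (inv (suc j) * f (suc j))))
      ≈⟨ sumUpTo-cong (suc n) (λ j _ → absorb j) ⟩
    sumUpTo (suc n) (λ j → inv (suc n) * (bernstein (suc n) (suc j) * f (suc j)))
      ≈⟨ *-distribˡ-sumUpTo (suc n) (inv (suc n)) _ ⟨
    inv (suc n) * binomialSum (suc n) f ∎
    where
    absorb : ∀ j →
      p * (bernstein n j * (inv (suc j) * f (suc j))) ≈ inv (suc n) * (bernstein (suc n) (suc j) * f (suc j))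
    absorb j = begin
      p * (fromℕ R (n C j) * pow R p j * pow R q (n ∸ j) * (inv (suc j) * f (suc j)))
        ≈⟨ solve 6 (λ P X Pʲ Q J⁻¹ F →
               P :* (X :* Pʲ :* Q :* (J⁻¹ :* F)) := (X :* J⁻¹) :* (P :* Pʲ) :* Q :* F)
             refl p (fromℕ R (n C j)) (pow R p j) (pow R q (n ∸ j)) (inv (suc j)) (f (suc j)) ⟩
      (fromℕ R (n C j) * inv (suc j)) * (p * pow R p j) * pow R q (n ∸ j) * f (suc j)
        ≈⟨ *-congʳ (*-congʳ (*-congʳ (C-inv-absorb n j))) ⟩
      (inv (suc n) * fromℕ R (suc n C suc j)) * (p * pow R p j) * pow R q (n ∸ j) * f (suc j)
        ≈⟨ solve 5 (λ N⁻¹ Y P Q F → (N⁻¹ :* Y) :* P :* Q :* F := N⁻¹ :* (Y :* P :* Q :* F))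
             refl (inv (suc n)) (fromℕ R (suc n C suc j)) (p * pow R p j) (pow R q (n ∸ j)) (f (suc j)) ⟩
      inv (suc n) * (bernstein (suc n) (suc j) * f (suc j)) ∎

  binomialSum-harmonic : ∀ n f →
    binomialSum n (λ k → sumUpTo k (λ i → inv (suc i) * f (suc i)))
      ≈ sumUpTo n (λ i → inv (suc i) * binomialSum (suc i) f)
  binomialSum-harmonic zero    f = trans (sumUpTo-zero _) (sym (sumUpTo-zero _))
  binomialSum-harmonic (suc n) f = begin
    binomialSum (suc n) H
      ≈⟨ binomialSum-suc n H ⟩
    q * binomialSum n H + p * binomialSum₀ n (H ∘ suc)
      ≈⟨ +-congˡ (*-congˡ shift) ⟩
    q * binomialSum n H + p * (binomialSum n H + binomialSum₀ n g)
      ≈⟨ solve 4 (λ Q P B S → Q :* B :+ P :* (B :+ S) := (Q :+ P) :* B :+ P :* S)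
           refl q p (binomialSum n H) (binomialSum₀ n g) ⟩
    (q + p) * binomialSum n H + p * binomialSum₀ n g
      ≈⟨ +-cong (trans (*-congʳ q+p≈1) (*-identityˡ _)) (binomialSum-absorb n f) ⟩
    binomialSum n H + inv (suc n) * binomialSum (suc n) f
      ≈⟨ +-congʳ (binomialSum-harmonic n f) ⟩
    sumUpTo n (λ i → inv (suc i) * binomialSum (suc i) f) + inv (suc n) * binomialSum (suc n) f
      ≈⟨ sumUpTo-sucʳ n _ ⟨
    sumUpTo (suc n) (λ i → inv (suc i) * binomialSum (suc i) f) ∎
    where
    g : ℕ → Carrier
    g k = inv (suc k) * f (suc k)
    H : ℕ → Carrier
    H k = sumUpTo k g
    shift : binomialSum₀ n (H ∘ suc) ≈ binomialSum n H + binomialSum₀ n g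
    shift = begin
      binomialSum₀ n (H ∘ suc)
        ≈⟨ sumUpTo-cong (suc n) (λ k _ → trans (*-congˡ (sumUpTo-sucʳ k g)) (distribˡ _ _ _)) ⟩
      sumUpTo (suc n) (λ k → bernstein n k * H k + bernstein n k * g k)
        ≈⟨ sumUpTo-+ (suc n) _ _ ⟩
      binomialSum₀ n H + binomialSum₀ n g
        ≈⟨ +-congʳ (binomialSum₀≈bernstein₀+binomialSum n H) ⟩
      (bernstein n 0 * H 0 + binomialSum n H) + binomialSum₀ n g
        ≈⟨ +-congʳ (trans (+-congʳ (trans (*-congˡ (sumUpTo-zero g)) (zeroʳ _))) (+-identityˡ _)) ⟩
      binomialSum n H + binomialSum₀ n g ∎

  binomialSum-inv : ∀ n f →
    binomialSum n (λ k → inv k * f k)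
      ≈ sumUpTo n (λ i → pow R q (n ∸ suc i) * (inv (suc i) * binomialSum (suc i) f))
  binomialSum-inv zero    f = trans (sumUpTo-zero _) (sym (sumUpTo-zero _))
  binomialSum-inv (suc n) f = begin
    binomialSum (suc n) (λ k → inv k * f k)
      ≈⟨ binomialSum-suc n (λ k → inv k * f k) ⟩
    q * binomialSum n (λ k → inv k * f k) + p * binomialSum₀ n (λ k → inv (suc k) * f (suc k))
      ≈⟨ +-cong (*-congˡ (binomialSum-inv n f)) (binomialSum-absorb n f) ⟩
    q * sumUpTo n (λ i → pow R q (n ∸ suc i) * T i) + T n
      ≈⟨ +-cong (trans (*-distribˡ-sumUpTo n q _) (sumUpTo-cong n raise)) (sym last) ⟩
    sumUpTo n (λ i → pow R q (n ∸ i) * T i) + pow R q (n ∸ n) * T n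
      ≈⟨ sumUpTo-sucʳ n _ ⟨
    sumUpTo (suc n) (λ i → pow R q (n ∸ i) * T i) ∎
    where
    T : ℕ → Carrier
    T i = inv (suc i) * binomialSum (suc i) f
    raise : ∀ i → i < n → q * (pow R q (n ∸ suc i) * T i) ≈ pow R q (n ∸ i) * T i
    raise i i<n = trans (sym (*-assoc _ _ _)) (*-congʳ (reflexive (cong (pow R q) (≡.sym (+-∸-assoc 1 i<n)))))
    last : pow R q (n ∸ n) * T n ≈ T n
    last = trans (*-congʳ (reflexive (cong (pow R q) (n∸n≡0 n)))) (*-identityˡ _)

  prodInv : List ℕ → Carrier
  prodInv ns = prodR R (map inv ns)

  binomialSum-pow-inv : ∀ t n f →
    binomialSum n (λ k → pow R (inv k) t * f k)
      ≈ chainSum n t (λ c → pow R q (n ∸ lastOr n c) * prodInv c * binomialSum (lastOr n c) f)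
  binomialSum-pow-inv zero    n f = begin
    binomialSum n (λ k → 1# * f k)
      ≈⟨ binomialSum-cong n (λ k → *-identityˡ (f k)) ⟩
    binomialSum n f
      ≈⟨ solve 1 (λ B → B := con 1 :* con 1 :* B :+ con 0) refl (binomialSum n f) ⟩
    1# * 1# * binomialSum n f + 0#
      ≈⟨ +-congʳ (*-congʳ (*-congʳ (reflexive (cong (pow R q) (≡.sym (n∸n≡0 n)))))) ⟩
    chainSum n 0 (λ c → pow R q (n ∸ lastOr n c) * prodInv c * binomialSum (lastOr n c) f) ∎
  binomialSum-pow-inv (suc t) n f = begin
    binomialSum n (λ k → (inv k * pow R (inv k) t) * f k)
      ≈⟨ binomialSum-cong n (λ k → *-assoc (inv k) (pow R (inv k) t) (f k)) ⟩
    binomialSum n (λ k → inv k * g k)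
      ≈⟨ binomialSum-inv n g ⟩
    sumUpTo n (λ i → pow R q (n ∸ suc i) * (inv (suc i) * binomialSum (suc i) g))
      ≈⟨ sumUpTo-cong n step ⟩
    sumUpTo n (λ i → chainSum (suc i) t (W n ∘ (suc i ∷_)))
      ≈⟨ chainSum-suc n t (W n) ⟨
    chainSum n (suc t) (W n) ∎
    where
    g : ℕ → Carrier
    g k = pow R (inv k) t * f k
    W : ℕ → List ℕ → Carrier
    W m c = pow R q (m ∸ lastOr m c) * prodInv c * binomialSum (lastOr m c) f
    step : ∀ i → i < n →
      pow R q (n ∸ suc i) * (inv (suc i) * binomialSum (suc i) g) ≈ chainSum (suc i) t (W n ∘ (suc i ∷_))
    step i i<n = begin
      pow R q (n ∸ suc i) * (inv (suc i) * binomialSum (suc i) g)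
        ≈⟨ *-congˡ (*-congˡ (binomialSum-pow-inv t (suc i) f)) ⟩
      pow R q (n ∸ suc i) * (inv (suc i) * chainSum (suc i) t (W (suc i)))
        ≈⟨ trans (*-congˡ (chainSum-*ˡ (suc i) t _ _)) (chainSum-*ˡ (suc i) t _ _) ⟩
      chainSum (suc i) t (λ c → pow R q (n ∸ suc i) * (inv (suc i) * W (suc i) c))
        ≈⟨ chainSum-cong (suc i) t (λ c _ l≤i → telescope c l≤i) ⟩
      chainSum (suc i) t (W n ∘ (suc i ∷_)) ∎
      where
      telescope : ∀ c → lastOr (suc i) c ≤ suc i →
        pow R q (n ∸ suc i) * (inv (suc i) * W (suc i) c) ≈ W n (suc i ∷ c)
      telescope c l≤i = begin
        pow R q (n ∸ suc i) * (inv (suc i) * (Qᵢ * prodInv c * B))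
          ≈⟨ solve 5 (λ Qₙ I Qᵢ P B → Qₙ :* (I :* (Qᵢ :* P :* B)) := (Qₙ :* Qᵢ) :* (I :* P) :* B)
               refl (pow R q (n ∸ suc i)) (inv (suc i)) Qᵢ (prodInv c) B ⟩
        (pow R q (n ∸ suc i) * Qᵢ) * (inv (suc i) * prodInv c) * B
          ≈⟨ *-congʳ (*-congʳ (pow-∸-telescope q l≤i i<n)) ⟩
        W n (suc i ∷ c) ∎
        where
        Qᵢ B : Carrier
        Qᵢ = pow R q (suc i ∸ lastOr (suc i) c)
        B = binomialSum (lastOr (suc i) c) f

  harmonic : ℕ → (ℕ → Carrier) → ℕ → Carrier
  harmonic t f k = sumUpTo k (λ i → pow R (inv (suc i)) t * f (suc i))

  blockWeight : ℕ → List ℕ → Carrier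
  blockWeight n c = pow R q (headOr n c ∸ lastOr n c) * prodInv c

  binomialSum-harmonic-suc : ∀ t n f →
    binomialSum n (harmonic (suc t) f)
      ≈ chainSum n (suc t) (λ c → blockWeight n c * binomialSum (lastOr n c) f)
  binomialSum-harmonic-suc t n f = begin
    binomialSum n (harmonic (suc t) f)
      ≈⟨ binomialSum-cong n (λ k → sumUpTo-cong k (λ i _ →
           *-assoc (inv (suc i)) (pow R (inv (suc i)) t) (f (suc i)))) ⟩
    binomialSum n (λ k → sumUpTo k (λ i → inv (suc i) * g (suc i)))
      ≈⟨ binomialSum-harmonic n g ⟩
    sumUpTo n (λ i → inv (suc i) * binomialSum (suc i) g)
      ≈⟨ sumUpTo-cong n (λ i _ → step i) ⟩
    sumUpTo n (λ i → chainSum (suc i) t (W ∘ (suc i ∷_)))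
      ≈⟨ chainSum-suc n t W ⟨
    chainSum n (suc t) W ∎
    where
    g : ℕ → Carrier
    g k = pow R (inv k) t * f k
    W : List ℕ → Carrier
    W c = blockWeight n c * binomialSum (lastOr n c) f
    step : ∀ i → inv (suc i) * binomialSum (suc i) g ≈ chainSum (suc i) t (W ∘ (suc i ∷_))
    step i = begin
      inv (suc i) * binomialSum (suc i) g
        ≈⟨ *-congˡ (binomialSum-pow-inv t (suc i) f) ⟩
      inv (suc i) * chainSum (suc i) t (λ c → Q c * prodInv c * B c)
        ≈⟨ chainSum-*ˡ (suc i) t _ _ ⟩
      chainSum (suc i) t (λ c → inv (suc i) * (Q c * prodInv c * B c))
        ≈⟨ chainSum-cong (suc i) t (λ c _ _ → solve 4 (λ I Q P B → I :* (Q :* P :* B) := Q :* (I :* P) :* B)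
             refl (inv (suc i)) (Q c) (prodInv c) (B c)) ⟩
      chainSum (suc i) t (W ∘ (suc i ∷_)) ∎
      where
      Q : List ℕ → Carrier
      Q c = pow R q (suc i ∸ lastOr (suc i) c)
      B : List ℕ → Carrier
      B c = binomialSum (lastOr (suc i) c) f

  binomialSum₀-pow : ∀ a n → binomialSum₀ n (pow R a) ≈ pow R (q + a * p) n
  binomialSum₀-pow a n = begin
    binomialSum₀ n (pow R a)
      ≈⟨ sumUpTo-cong (suc n) (λ k _ → term k) ⟩
    sumUpTo (suc n) (λ k → (n C k) × ((a * p) ^ k * q ^ (n ∸ k)))
      ≡⟨ sumUpTo≡sum (suc n) _ ⟩
    binomialExpansion (a * p) q n
      ≈⟨ binomial-theorem n (a * p) q ⟨
    (a * p + q) ^ n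
      ≈⟨ ^-congˡ n (+-comm (a * p) q) ⟩
    (q + a * p) ^ n
      ≡⟨ pow≡^ (q + a * p) n ⟨
    pow R (q + a * p) n ∎
    where
    term : ∀ k → bernstein n k * pow R a k ≈ (n C k) × ((a * p) ^ k * q ^ (n ∸ k))
    term k = begin
      fromℕ R (n C k) * pow R p k * pow R q (n ∸ k) * pow R a k
        ≈⟨ solve 4 (λ C P Q A → C :* P :* Q :* A := C :* ((A :* P) :* Q))
             refl (fromℕ R (n C k)) (pow R p k) (pow R q (n ∸ k)) (pow R a k) ⟩
      fromℕ R (n C k) * ((pow R a k * pow R p k) * pow R q (n ∸ k))
        ≡⟨ cong₂ (λ x y → fromℕ R (n C k) * (x * y))
             (cong₂ _*_ (pow≡^ a k) (pow≡^ p k)) (pow≡^ q (n ∸ k)) ⟩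
      fromℕ R (n C k) * ((a ^ k * p ^ k) * q ^ (n ∸ k))
        ≈⟨ *-congˡ (*-congʳ (^-distrib-* a p k)) ⟨
      fromℕ R (n C k) * ((a * p) ^ k * q ^ (n ∸ k))
        ≈⟨ fromℕ-*≈× (n C k) _ ⟩
      (n C k) × ((a * p) ^ k * q ^ (n ∸ k)) ∎

  binomialSum-pow : ∀ a n → binomialSum n (pow R a) ≈ pow R (q + a * p) n - pow R q n
  binomialSum-pow a n = begin
    binomialSum n (pow R a)
      ≈⟨ //-rightDividesʳ (pow R q n) _ ⟨
    binomialSum n (pow R a) + pow R q n - pow R q n
      ≈⟨ +-congʳ (+-comm _ _) ⟩
    pow R q n + binomialSum n (pow R a) - pow R q n
      ≈⟨ +-congʳ (+-congʳ bernstein₀) ⟨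
    bernstein n 0 * 1# + binomialSum n (pow R a) - pow R q n
      ≈⟨ +-congʳ (binomialSum₀≈bernstein₀+binomialSum n (pow R a)) ⟨
    binomialSum₀ n (pow R a) - pow R q n
      ≈⟨ +-congʳ (binomialSum₀-pow a n) ⟩
    pow R (q + a * p) n - pow R q n ∎
    where
    bernstein₀ : bernstein n 0 * 1# ≈ pow R q n
    bernstein₀ = solve 1 (λ Q → (con 1 :+ con 0) :* con 1 :* Q :* con 1 := Q) refl (pow R q n)

module ZetaStar {ℓ₁ ℓ₂ : Level} (R : CommutativeRing ℓ₁ ℓ₂)
  (inv : ℕ → CommutativeRing.Carrier R)
  (inv-correct : Reciprocals R inv)
  (a p : CommutativeRing.Carrier R) where
  open CommutativeRing R
  open Sums R
  open Binomial R inv inv-correct p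
  open import Relation.Binary.Reasoning.Setoid setoid
  open import Algebra.Solver.Ring.NaturalCoefficients.Default commutativeSemiring

  nestedHarmonic : List ℕ → (ℕ → Carrier) → ℕ → Carrier
  nestedHarmonic []      g = g
  nestedHarmonic (t ∷ s) g = harmonic t (nestedHarmonic s g)

  invPowProduct : List ℕ → List ℕ → Carrier
  invPowProduct c s = prodR R (zipWith (λ n t → pow R (inv n) t) c s)

  chainSum-nestedHarmonic : ∀ k s g →
    chainSum k (length s) (λ c → g (lastOr k c) * invPowProduct c s) ≈ nestedHarmonic s g k
  chainSum-nestedHarmonic k []      g = trans (+-identityʳ _) (*-identityʳ _)
  chainSum-nestedHarmonic k (t ∷ s) g = begin
    chainSum k (suc (length s)) F
      ≈⟨ chainSum-suc k (length s) F ⟩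
    sumUpTo k (λ i → chainSum (suc i) (length s) (F ∘ (suc i ∷_)))
      ≈⟨ sumUpTo-cong k (λ i _ → step i) ⟩
    nestedHarmonic (t ∷ s) g k ∎
    where
    F : List ℕ → Carrier
    F c = g (lastOr k c) * invPowProduct c (t ∷ s)
    step : ∀ i →
      chainSum (suc i) (length s) (F ∘ (suc i ∷_)) ≈ pow R (inv (suc i)) t * nestedHarmonic s g (suc i)
    step i = begin
      chainSum (suc i) (length s) (F ∘ (suc i ∷_))
        ≈⟨ chainSum-cong (suc i) (length s) (λ c _ _ → solve 3 (λ G X Y → G :* (X :* Y) := X :* (G :* Y))
             refl (g (lastOr (suc i) c)) (pow R (inv (suc i)) t) (invPowProduct c s)) ⟩
      chainSum (suc i) (length s) (λ c → pow R (inv (suc i)) t * (g (lastOr (suc i) c) * invPowProduct c s))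
        ≈⟨ chainSum-*ˡ (suc i) (length s) _ _ ⟨
      pow R (inv (suc i)) t * chainSum (suc i) (length s) (λ c → g (lastOr (suc i) c) * invPowProduct c s)
        ≈⟨ *-congˡ (chainSum-nestedHarmonic (suc i) s g) ⟩
      pow R (inv (suc i)) t * nestedHarmonic s g (suc i) ∎

  zetaStar≈nestedHarmonic : ∀ k s → 1 ≤ length s → zetaStar R inv k s a ≈ nestedHarmonic s (pow R a) k
  zetaStar≈nestedHarmonic k s 1≤d = trans
    (chainSum-cong k (length s) (λ c len _ → *-congʳ (reflexive (cong (pow R a) (idx-length k c len 1≤d)))))
    (chainSum-nestedHarmonic k s (pow R a))

  blocks : ℕ → List ℕ → Carrier
  blocks n []      = pow R (q + a * p) n - pow R q n
  blocks n (t ∷ s) = chainSum n t (λ c → blockWeight n c * blocks (lastOr n c) s)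

  binomialSum-nestedHarmonic : ∀ n s → All (1 ≤_) s →
    binomialSum n (nestedHarmonic s (pow R a)) ≈ blocks n s
  binomialSum-nestedHarmonic n []          []              = binomialSum-pow a n
  binomialSum-nestedHarmonic n (suc t ∷ s) (s≤s z≤n ∷ 1≤s) = begin
    binomialSum n (harmonic (suc t) (nestedHarmonic s (pow R a)))
      ≈⟨ binomialSum-harmonic-suc t n (nestedHarmonic s (pow R a)) ⟩
    chainSum n (suc t) (λ c → blockWeight n c * binomialSum (lastOr n c) (nestedHarmonic s (pow R a)))
      ≈⟨ chainSum-cong n (suc t) (λ c _ _ → *-congˡ (binomialSum-nestedHarmonic (lastOr n c) s 1≤s)) ⟩
    blocks n (suc t ∷ s) ∎

  lhs2≈blocks : ∀ n s → 1 ≤ length s → All (1 ≤_) s → lhs2 R inv n s a p ≈ blocks n s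
  lhs2≈blocks n s 1≤d 1≤s = begin
    lhs2 R inv n s a p
      ≈⟨ sumR-oneTo n _ ⟩
    binomialSum n (λ k → zetaStar R inv k s a)
      ≈⟨ binomialSum-cong n (λ k → zetaStar≈nestedHarmonic k s 1≤d) ⟩
    binomialSum n (nestedHarmonic s (pow R a))
      ≈⟨ binomialSum-nestedHarmonic n s 1≤s ⟩
    blocks n s ∎

  blockProduct : List ℕ → List ℕ → Carrier
  blockProduct s c =
    prodR R (map (λ r → pow R q (idx c (suc (psum s (r ∸ 1))) ∸ idx c (psum s r))) (oneTo (length s)))

  blockProduct-firstFactor : ∀ x c₁ c₂ s →
    pow R q (idx ((x ∷ c₁) ++ c₂) 1 ∸ idx ((x ∷ c₁) ++ c₂) (psum (length (x ∷ c₁) ∷ s) 1))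
      ≡ pow R q (x ∸ lastOr x c₁)
  blockProduct-firstFactor x c₁ c₂ s = cong (λ m → pow R q (x ∸ m))
    (≡.trans (cong (idx ((x ∷ c₁) ++ c₂)) (ℕ.+-identityʳ (length (x ∷ c₁))))
             (idx-++-length x (x ∷ c₁) c₂ (s≤s z≤n)))

  prodInv-++ : ∀ xs ys → prodInv (xs ++ ys) ≈ prodInv xs * prodInv ys
  prodInv-++ xs ys = trans (reflexive (cong (prodR R) (map-++ inv xs ys))) (foldr-∙-++ *-monoid (map inv xs) _)

  blockProduct-++ : ∀ n {t} s c₁ c₂ → length c₁ ≡ suc t → All (1 ≤_) s →
    blockProduct (suc t ∷ s) (c₁ ++ c₂) ≈ pow R q (headOr n c₁ ∸ lastOr n c₁) * blockProduct s c₂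
  blockProduct-++ n []          (x ∷ c₁) c₂ ≡.refl []              =
    reflexive (cong (_* 1#) (blockProduct-firstFactor x c₁ c₂ []))
  blockProduct-++ n (suc u ∷ s) (x ∷ c₁) c₂ ≡.refl (s≤s z≤n ∷ _) = begin
    prodR R (map φ (oneTo (suc L)))
      ≡⟨ cong (λ rs → prodR R (map φ rs)) (oneTo-suc L) ⟩
    φ 1 * prodR R (map φ (map suc (oneTo L)))
      ≡⟨ cong₂ _*_ (blockProduct-firstFactor x c₁ c₂ (suc u ∷ s))
           (cong (prodR R) (≡.trans (≡.sym (map-∘ (oneTo L))) (≡.sym (map-∘ (upTo L))))) ⟩
    pow R q (x ∸ lastOr x c₁) * prodR R (map (φ ∘ suc ∘ suc) (upTo L))
      ≡⟨ cong (λ rs → pow R q (x ∸ lastOr x c₁) * prodR R rs)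
           (≡.trans (map-cong blockProduct-laterFactor (upTo L)) (map-∘ (upTo L))) ⟩
    pow R q (x ∸ lastOr x c₁) * blockProduct (suc u ∷ s) c₂ ∎
    where
    L : ℕ
    L = length (suc u ∷ s)
    xs : List ℕ
    xs = x ∷ c₁
    φ : ℕ → Carrier
    φ r = pow R q (idx (xs ++ c₂) (suc (psum (length xs ∷ suc u ∷ s) (r ∸ 1)))
                   ∸ idx (xs ++ c₂) (psum (length xs ∷ suc u ∷ s) r))
    blockProduct-laterFactor : ∀ r →
      φ (suc (suc r)) ≡ pow R q (idx c₂ (suc (psum (suc u ∷ s) r)) ∸ idx c₂ (psum (suc u ∷ s) (suc r)))
    blockProduct-laterFactor r = cong₂ (λ i j → pow R q (i ∸ j))
      (idx-++ʳ xs c₂ (psum (suc u ∷ s) r))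
      (≡.trans (cong (idx (xs ++ c₂)) (ℕ.+-suc (length xs) (u ℕ.+ psum s r)))
               (idx-++ʳ xs c₂ (u ℕ.+ psum s r)))

  chainSum-blockProduct : ∀ n s → All (1 ≤_) s →
    chainSum n (psum s (length s)) (λ c → blockProduct s c * prodInv c * blocks (lastOr n c) []) ≈ blocks n s
  chainSum-blockProduct n []          []              =
    solve 1 (λ X → con 1 :* con 1 :* X :+ con 0 := X) refl (blocks n [])
  chainSum-blockProduct n (suc t ∷ s) (s≤s z≤n ∷ 1≤s) = begin
    chainSum n (suc t ℕ.+ N) F
      ≈⟨ chainSum-+ n (suc t) N F ⟩
    chainSum n (suc t) (λ c₁ → chainSum (lastOr n c₁) N (F ∘ (c₁ ++_)))
      ≈⟨ chainSum-cong n (suc t) (λ c₁ len _ → splitOff c₁ len) ⟩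
    blocks n (suc t ∷ s) ∎
    where
    N : ℕ
    N = psum s (length s)
    F : List ℕ → Carrier
    F c = blockProduct (suc t ∷ s) c * prodInv c * blocks (lastOr n c) []
    splitOff : ∀ c₁ → length c₁ ≡ suc t →
      chainSum (lastOr n c₁) N (F ∘ (c₁ ++_)) ≈ blockWeight n c₁ * blocks (lastOr n c₁) s
    splitOff c₁ len = begin
      chainSum (lastOr n c₁) N (F ∘ (c₁ ++_))
        ≈⟨ chainSum-cong (lastOr n c₁) N (λ c₂ _ _ → factor c₂) ⟩
      chainSum (lastOr n c₁) N (λ c₂ → blockWeight n c₁ * G c₂)
        ≈⟨ chainSum-*ˡ (lastOr n c₁) N _ G ⟨
      blockWeight n c₁ * chainSum (lastOr n c₁) N G
        ≈⟨ *-congˡ (chainSum-blockProduct (lastOr n c₁) s 1≤s) ⟩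
      blockWeight n c₁ * blocks (lastOr n c₁) s ∎
      where
      G : List ℕ → Carrier
      G c₂ = blockProduct s c₂ * prodInv c₂ * blocks (lastOr (lastOr n c₁) c₂) []
      factor : ∀ c₂ → F (c₁ ++ c₂) ≈ blockWeight n c₁ * G c₂
      factor c₂ = begin
        blockProduct (suc t ∷ s) (c₁ ++ c₂) * prodInv (c₁ ++ c₂) * blocks (lastOr n (c₁ ++ c₂)) []
          ≈⟨ *-cong (*-cong (blockProduct-++ n s c₁ c₂ len 1≤s) (prodInv-++ c₁ c₂))
               (reflexive (cong (λ m → blocks m []) (lastOr-++ n c₁ c₂))) ⟩
        (Q * blockProduct s c₂) * (prodInv c₁ * prodInv c₂) * blocks (lastOr (lastOr n c₁) c₂) []
          ≈⟨ solve 5 (λ Q B I₁ I₂ X → (Q :* B) :* (I₁ :* I₂) :* X := (Q :* I₁) :* (B :* I₂ :* X))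
               refl Q (blockProduct s c₂) (prodInv c₁) (prodInv c₂) (blocks (lastOr (lastOr n c₁) c₂) []) ⟩
        blockWeight n c₁ * G c₂ ∎
        where
        Q : Carrier
        Q = pow R q (headOr n c₁ ∸ lastOr n c₁)

  rhs2≈blocks : ∀ n s → 1 ≤ length s → All (1 ≤_) s → rhs2 R inv n s a p ≈ blocks n s
  rhs2≈blocks n s@(s₁ ∷ _) _ 1≤s@(1≤s₁ ∷ _) = trans
    (chainSum-cong n N (λ c len _ → *-congˡ (reflexive (cong (λ m → blocks m []) (idx-length n c len 1≤N)))))
    (chainSum-blockProduct n s 1≤s)
    where
    N : ℕ
    N = psum s (length s)
    1≤N : 1 ≤ N
    1≤N = ≤-trans 1≤s₁ (ℕ.m≤m+n s₁ _)

theorem2 : {c ℓ : Level} (R : CommutativeRing c ℓ)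
    → (inv : ℕ → CommutativeRing.Carrier R)
    → (∀ m → CommutativeRing._≈_ R (CommutativeRing._*_ R (fromℕ R (suc m)) (inv (suc m))) (CommutativeRing.1# R))
    → (n : ℕ) (s : List ℕ) → 1 ≤ length s → All (1 ≤_) s
    → (a p : CommutativeRing.Carrier R)
    → CommutativeRing._≈_ R (lhs2 R inv n s a p) (rhs2 R inv n s a p)
theorem2 R inv inv-correct n s 1≤d 1≤s a p =
  trans (lhs2≈blocks n s 1≤d 1≤s) (sym (rhs2≈blocks n s 1≤d 1≤s))
  where
  open CommutativeRing R using (trans; sym)
  open ZetaStar R inv inv-correct a p
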